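{- Let $l\ge 3$ and $n\ge 3$, and let $lT_2^2$ denote the $2\times l$ matrix all of whose columns equal $(1,1)^T$. Then $\mathrm{sat}(n,lT_2^2)\ge 2n+1$.
   Context: All matrices are $0$-$1$ matrices. A matrix is simple if it has no repeated columns. A matrix $F$ is a submatrix of $A$ if, after deleting some rows and columns of $A$, one obtains a row and column permutation of $F$. A simple $n$-row matrix $M$ is $F$-saturated if it does not contain $F$ as a submatrix but appending any $n$-column not already a column of $M$ produces a matrix containing $F$; $\mathrm{sat}(n,F)$ is the minimum number of columns of an $F$-saturated $n$-row matrix. -}

module Defs where

open import Data.Nat using (ℕ; suc)
open import Data.Bool using (Bool; true)
open import Data.Fin as Fin using (Fin)
open import Data.Vec using (Vec; lookup; replicate)
open import Data.Product using (Σ; _×_)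
open import Relation.Binary.PropositionalEquality using (_≡_)
open import Relation.Nullary using (¬_)
open import Function.Definitions using (Injective)

-- An n-row matrix with m columns, given as its list of columns
-- (column j is a vector of length n).
Matrix : ℕ → ℕ → Set
Matrix n m = Fin m → Vec Bool n

entry : ∀ {n m} → Matrix n m → Fin n → Fin m → Bool
entry A i j = lookup (A j) i

Simple : ∀ {n m} → Matrix n m → Set
Simple A = Injective _≡_ _≡_ A

-- F (k rows, p columns) is a submatrix of A (n rows, m columns):
-- there are distinct rows r(0..k-1) and distinct columns c(0..p-1) of A
-- such that A restricted to them is F; choosing the order of the
-- selected rows/columns accounts for row and column permutations.
Contains : ∀ {n m k p} → Matrix n m → Matrix k p → Set
Contains {n} {m} {k} {p} A F =
  Σ (Fin k → Fin n) λ r → Σ (Fin p → Fin m) λ c →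
    Injective _≡_ _≡_ r × Injective _≡_ _≡_ c ×
    (∀ (i : Fin k) (j : Fin p) → entry A (r i) (c j) ≡ entry F i j)

-- append a column x to A (placed as the first column; column order is
-- irrelevant for containment)
append : ∀ {n m} → Matrix n m → Vec Bool n → Matrix n (suc m)
append A x Fin.zero = x
append A x (Fin.suc j) = A j

Saturated : ∀ {n m k p} → Matrix n m → Matrix k p → Set
Saturated {n} {m} M F =
  Simple M × ¬ Contains M F ×
  (∀ (x : Vec Bool n) → (∀ (j : Fin m) → ¬ (M j ≡ x)) → Contains (append M x) F)

lT22 : (l : ℕ) → Matrix 2 l
lT22 l _ = replicate 2 true

-- Write l = L + 1 and let M be an lT₂²-saturated matrix. A copy of lT₂² amounts to two rows
-- whose codegree (number of columns with 1s in both) is at least l. So distinct rows of M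
-- have codegree at most L, and any new column must contain a pair of rows of codegree L.
-- Hence M contains the zero column and the n unit columns (all "light"), and the column
-- {u, v} for every pair of codegree below L. It remains to find n "heavy" columns (at
-- least two 1s). By Gaussian elimination it suffices that only x = 0 is orthogonal, over ℤ,
-- to all heavy columns. For such x the sum of squares Σ_heavy ⟨c, x⟩² = Σ_{u,v} C_uv x_u x_v
-- vanishes, where C, the Gram matrix of the heavy columns, is the codegree off the diagonal
-- and exceeds L on the diagonal wherever x_u ≠ 0, while low-codegree pairs force
-- x_u + x_v = 0. Then the form dominates L (Σ x)² with strict inequality, so x = 0.
module Submission where

open import Data.Nat as ℕ using (ℕ; zero; suc; z≤n; s≤s)
open import Data.Bool using (Bool; true; false; _∧_)
open import Data.Bool.Properties using (∧-conicalˡ; ∧-conicalʳ)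
open import Data.Fin as Fin using (Fin; zero; suc; punchIn; punchOut)
import Data.Fin.Properties as FinP
open import Data.Product using (Σ; ∃; _×_; _,_; proj₁; proj₂)
open import Data.Empty using (⊥; ⊥-elim)
open import Function using (_∘_; id; case_of_)
open import Function.Definitions using (Injective)
open import Relation.Binary.PropositionalEquality
open import Relation.Nullary using (¬_; Dec; yes; no; does)
open import Defs

does-true : ∀ {A : Set} (a? : Dec A) → does a? ≡ true → A
does-true (yes a) _ = a

≟-sound : ∀ {k} {a b : Fin k} → does (a Fin.≟ b) ≡ true → a ≡ b
≟-sound {a = a} {b} = does-true (a Fin.≟ b)

∧-intro : ∀ {x y} → x ≡ true → y ≡ true → x ∧ y ≡ true
∧-intro refl refl = refl

two-others : ∀ {n} → 3 ℕ.≤ n → (u : Fin n) →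
  Σ (Fin n) λ w → Σ (Fin n) λ w' → u ≢ w × u ≢ w' × w ≢ w'
two-others (s≤s (s≤s (s≤s _))) zero = suc zero , suc (suc zero) , (λ ()) , (λ ()) , (λ ())
two-others (s≤s (s≤s (s≤s _))) (suc zero) = zero , suc (suc zero) , (λ ()) , (λ ()) , (λ ())
two-others (s≤s (s≤s (s≤s _))) (suc (suc u)) = zero , suc zero , (λ ()) , (λ ()) , (λ ())

module Counting where
  open import Data.Nat using (_+_; _≤_; s≤s⁻¹)
  open import Data.Nat.Properties using (m≤n⇒m≤1+n; ≤-trans; m≤n+m; +-suc)
  open import Data.Bool using (not)

  bit : Bool → ℕ
  bit true = 1
  bit false = 0

  count : ∀ {m} → (Fin m → Bool) → ℕ
  count {zero} p = 0
  count {suc m} p = bit (p zero) + count (p ∘ suc)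

  Witnesses : ∀ {m} → (Fin m → Bool) → ℕ → Set
  Witnesses {m} p k = Σ (Fin k → Fin m) λ f → Injective _≡_ _≡_ f × (∀ i → p (f i) ≡ true)

  count-cong : ∀ {m} {p q : Fin m → Bool} → (∀ j → p j ≡ q j) → count p ≡ count q
  count-cong {zero} e = refl
  count-cong {suc m} e = cong₂ _+_ (cong bit (e zero)) (count-cong (e ∘ suc))

  count-mono : ∀ {m} (p q : Fin m → Bool) → (∀ j → q j ≡ true → p j ≡ true) → count q ≤ count p
  count-mono {zero} p q q⇒p = z≤n
  count-mono {suc m} p q q⇒p with q zero in q₀ | p zero in p₀
  ... | true  | true  = s≤s (count-mono (p ∘ suc) (q ∘ suc) (q⇒p ∘ suc))
  ... | true  | false with () ← trans (sym (q⇒p zero q₀)) p₀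
  ... | false | true  = m≤n⇒m≤1+n (count-mono (p ∘ suc) (q ∘ suc) (q⇒p ∘ suc))
  ... | false | false = count-mono (p ∘ suc) (q ∘ suc) (q⇒p ∘ suc)

  count-mono-< : ∀ {m} (p q : Fin m → Bool) → (∀ j → q j ≡ true → p j ≡ true) →
    (j₀ : Fin m) → p j₀ ≡ true → q j₀ ≡ false → suc (count q) ≤ count p
  count-mono-< p q q⇒p zero p₀ q₀ rewrite p₀ | q₀ = s≤s (count-mono (p ∘ suc) (q ∘ suc) (q⇒p ∘ suc))
  count-mono-< p q q⇒p (suc j₀) pj qj with q zero in q₀ | p zero in p₀
  ... | true  | true  = s≤s (count-mono-< (p ∘ suc) (q ∘ suc) (q⇒p ∘ suc) j₀ pj qj)
  ... | true  | false with () ← trans (sym (q⇒p zero q₀)) p₀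
  ... | false | true  = m≤n⇒m≤1+n (count-mono-< (p ∘ suc) (q ∘ suc) (q⇒p ∘ suc) j₀ pj qj)
  ... | false | false = count-mono-< (p ∘ suc) (q ∘ suc) (q⇒p ∘ suc) j₀ pj qj

  count-complement : ∀ {m} (p : Fin m → Bool) → count p + count (not ∘ p) ≡ m
  count-complement {zero} p = refl
  count-complement {suc m} p with p zero
  ... | true  = cong suc (count-complement (p ∘ suc))
  ... | false = trans (+-suc (count (p ∘ suc)) (count (not ∘ p ∘ suc))) (cong suc (count-complement (p ∘ suc)))

  witnesses₂ : ∀ {m} {p : Fin m → Bool} {a b} → a ≢ b → p a ≡ true → p b ≡ true → Witnesses p 2
  witnesses₂ {m} {p} {a} {b} a≢b pa pb = f , f-inj , pf
    where
    f : Fin 2 → Fin m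
    f zero = a
    f (suc zero) = b
    f-inj : Injective _≡_ _≡_ f
    f-inj {zero}     {zero}     _ = refl
    f-inj {zero}     {suc zero} e = ⊥-elim (a≢b e)
    f-inj {suc zero} {zero}     e = ⊥-elim (a≢b (sym e))
    f-inj {suc zero} {suc zero} _ = refl
    pf : ∀ i → p (f i) ≡ true
    pf zero = pa
    pf (suc zero) = pb

  witnesses₃ : ∀ {m} {p : Fin m → Bool} {a b c} → a ≢ b → a ≢ c → b ≢ c →
    p a ≡ true → p b ≡ true → p c ≡ true → Witnesses p 3
  witnesses₃ {m} {p} {a} {b} {c} a≢b a≢c b≢c pa pb pc = f , f-inj , pf
    where
    f : Fin 3 → Fin m
    f zero = a
    f (suc zero) = b
    f (suc (suc zero)) = c
    f-inj : Injective _≡_ _≡_ f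
    f-inj {zero}           {zero}           _ = refl
    f-inj {zero}           {suc zero}       e = ⊥-elim (a≢b e)
    f-inj {zero}           {suc (suc zero)} e = ⊥-elim (a≢c e)
    f-inj {suc zero}       {zero}           e = ⊥-elim (a≢b (sym e))
    f-inj {suc zero}       {suc zero}       _ = refl
    f-inj {suc zero}       {suc (suc zero)} e = ⊥-elim (b≢c e)
    f-inj {suc (suc zero)} {zero}           e = ⊥-elim (a≢c (sym e))
    f-inj {suc (suc zero)} {suc zero}       e = ⊥-elim (b≢c (sym e))
    f-inj {suc (suc zero)} {suc (suc zero)} _ = refl
    pf : ∀ i → p (f i) ≡ true
    pf zero = pa
    pf (suc zero) = pb
    pf (suc (suc zero)) = pc

  avoid-zero : ∀ {k m} (f : Fin k → Fin (suc m)) → Injective _≡_ _≡_ f → (z≢f : ∀ i → zero ≢ f i) →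
    Σ (Fin k → Fin m) λ g → Injective _≡_ _≡_ g × (∀ i → suc (g i) ≡ f i)
  avoid-zero f f-inj z≢f =
    (λ i → punchOut (z≢f i)) , (λ e → f-inj (FinP.punchOut-injective (z≢f _) (z≢f _) e)) ,
    (λ i → FinP.punchIn-punchOut (z≢f i))

  witnesses⇒≤count : ∀ {m} (p : Fin m → Bool) {k} → Witnesses p k → k ≤ count p
  witnesses⇒≤count p {zero} _ = z≤n
  witnesses⇒≤count {zero} p {suc k} (f , _) with () ← f zero
  witnesses⇒≤count {suc m} p {suc k} (f , f-inj , pf) with FinP.any? (λ i → f i Fin.≟ zero)
  ... | yes (i₀ , fi₀≡0) = subst (λ b → suc k ≤ bit b + count (p ∘ suc)) p₀ (s≤s (witnesses⇒≤count (p ∘ suc) rest))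
    where
    p₀ : true ≡ p zero
    p₀ = trans (sym (pf i₀)) (cong p fi₀≡0)
    z≢f : ∀ i → zero ≢ f (punchIn i₀ i)
    z≢f i e = FinP.punchInᵢ≢i i₀ i (f-inj (trans (sym e) (sym fi₀≡0)))
    rest : Witnesses (p ∘ suc) k
    rest with avoid-zero (f ∘ punchIn i₀) (FinP.punchIn-injective i₀ _ _ ∘ f-inj) z≢f
    ... | g , g-inj , sg≡f = g , g-inj , λ i → trans (cong p (sg≡f i)) (pf (punchIn i₀ i))
  ... | no ∄i₀ = ≤-trans (witnesses⇒≤count (p ∘ suc) rest) (m≤n+m _ (bit (p zero)))
    where
    rest : Witnesses (p ∘ suc) (suc k)
    rest with avoid-zero f f-inj (λ i e → ∄i₀ (i , sym e))
    ... | g , g-inj , sg≡f = g , g-inj , λ i → trans (cong p (sg≡f i)) (pf i)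

  count⇒witnesses : ∀ {m} (p : Fin m → Bool) {k} → k ≤ count p → Witnesses p k
  count⇒witnesses p {zero} _ = (λ ()) , (λ { {()} }) , (λ ())
  count⇒witnesses {suc m} p {suc k} le with p zero in p₀
  ... | true with count⇒witnesses (p ∘ suc) (s≤s⁻¹ le)
  ...   | f , f-inj , pf = g , g-inj , pg
    where
    g : Fin (suc k) → Fin (suc m)
    g zero = zero
    g (suc i) = suc (f i)
    g-inj : Injective _≡_ _≡_ g
    g-inj {zero}  {zero}  _ = refl
    g-inj {suc i} {suc j} e = cong suc (f-inj (FinP.suc-injective e))
    pg : ∀ i → p (g i) ≡ true
    pg zero = p₀
    pg (suc i) = pf i
  count⇒witnesses {suc m} p {suc k} le | false with count⇒witnesses (p ∘ suc) le
  ...   | f , f-inj , pf = suc ∘ f , f-inj ∘ FinP.suc-injective , pf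

module AllOnesBlock where
  open import Data.Nat using (_≤_)
  open Counting

  common : ∀ {n m} → Matrix n m → Fin n → Fin n → Fin m → Bool
  common A a b j = entry A a j ∧ entry A b j

  codegree : ∀ {n m} → Matrix n m → Fin n → Fin n → ℕ
  codegree A a b = count (common A a b)

  block-from-codegree : ∀ {n m l} (A : Matrix n m) {a b : Fin n} → a ≢ b →
    l ≤ codegree A a b → Contains A (lT22 l)
  block-from-codegree {n} {l = l} A {a} {b} a≢b l≤ with count⇒witnesses (common A a b) l≤
  ... | c , c-inj , both = rows , c , proj₁ (proj₂ two-rows) , c-inj , ones
    where
    two-rows : Witnesses (λ _ → true) 2
    two-rows = witnesses₂ a≢b refl refl
    rows : Fin 2 → Fin n
    rows = proj₁ two-rows
    ones : ∀ i j → entry A (rows i) (c j) ≡ entry (lT22 l) i j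
    ones zero j = ∧-conicalˡ _ _ (both j)
    ones (suc zero) j = ∧-conicalʳ _ _ (both j)

  codegree-from-block : ∀ {n m l} (A : Matrix n m) → Contains A (lT22 l) →
    Σ (Fin n) λ a → Σ (Fin n) λ b → a ≢ b × l ≤ codegree A a b
  codegree-from-block A (r , c , r-inj , c-inj , ones) =
    r zero , r (suc zero) , (λ e → 0≢1 (r-inj e)) ,
    witnesses⇒≤count (common A _ _) (c , c-inj , λ j → ∧-intro (ones zero j) (ones (suc zero) j))
    where
    0≢1 : zero ≢ suc zero
    0≢1 ()

module IntegerSums where
  open import Data.Integer using (ℤ; +_; 0ℤ; 1ℤ; _+_; _*_; _≤_; _<_)
  import Data.Integer.Properties as ℤP
  open import Algebra.Properties.Semiring.Sum ℤP.+-*-semiring public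
    using (sum; sum-syntax; sum-cong-≗; ∑-distrib-+; ∑-comm; *-distribˡ-sum; *-distribʳ-sum)
  open import Data.Bool using (_∨_)
  open Counting using (bit; count)

  ι : Bool → ℤ
  ι b = + bit b

  sum-ι : ∀ {m} (p : Fin m → Bool) → ∑[ j < m ] ι (p j) ≡ + count p
  sum-ι {zero} p = refl
  sum-ι {suc m} p = cong (λ s → ι (p zero) + s) (sum-ι (p ∘ suc))

  sum-zero : ∀ {n} {f : Fin n → ℤ} → (∀ i → f i ≡ 0ℤ) → sum f ≡ 0ℤ
  sum-zero {zero} f≡0 = refl
  sum-zero {suc n} f≡0 = cong₂ _+_ (f≡0 zero) (sum-zero (f≡0 ∘ suc))

  ι-∨ : ∀ a b → (a ≡ true → b ≡ true → ⊥) → ι (a ∨ b) ≡ ι a + ι b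
  ι-∨ true  true  exclusive = ⊥-elim (exclusive refl refl)
  ι-∨ true  false _ = refl
  ι-∨ false b     _ = refl

  δ : ∀ {n} → Fin n → Fin n → ℤ
  δ a i = ι (does (a Fin.≟ i))

  sum-δ : ∀ {n} (a : Fin n) (g : Fin n → ℤ) → ∑[ i < n ] (δ a i * g i) ≡ g a
  sum-δ {suc n} zero g = begin
    1ℤ * g zero + ∑[ i < n ] (0ℤ * g (suc i))
      ≡⟨ cong₂ _+_ (ℤP.*-identityˡ (g zero)) (sum-zero (λ i → ℤP.*-zeroˡ (g (suc i)))) ⟩
    g zero + 0ℤ
      ≡⟨ ℤP.+-identityʳ (g zero) ⟩
    g zero ∎
    where open ≡-Reasoning
  sum-δ {suc n} (suc a) g = trans (ℤP.+-identityˡ _) (sum-δ a (g ∘ suc))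

  sum-mono-≤ : ∀ {n} {f g : Fin n → ℤ} → (∀ i → f i ≤ g i) → sum f ≤ sum g
  sum-mono-≤ {zero} f≤g = ℤP.≤-refl
  sum-mono-≤ {suc n} f≤g = ℤP.+-mono-≤ (f≤g zero) (sum-mono-≤ (f≤g ∘ suc))

  sum-mono-< : ∀ {n} {f g : Fin n → ℤ} → (∀ i → f i ≤ g i) → (i₀ : Fin n) → f i₀ < g i₀ → sum f < sum g
  sum-mono-< f≤g zero f<g = ℤP.+-mono-<-≤ f<g (sum-mono-≤ (f≤g ∘ suc))
  sum-mono-< f≤g (suc i₀) f<g = ℤP.+-mono-≤-< (f≤g zero) (sum-mono-< (f≤g ∘ suc) i₀ f<g)

  sum-*-sum : ∀ {m n} (f : Fin m → ℤ) (g : Fin n → ℤ) →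
    sum f * sum g ≡ ∑[ u < m ] ∑[ v < n ] (f u * g v)
  sum-*-sum f g = trans (*-distribʳ-sum (sum g) f) (sum-cong-≗ (λ u → *-distribˡ-sum (f u) g))

module HomogeneousSystems where
  open import Data.Integer using (ℤ; 0ℤ; 1ℤ; _+_; _*_; -_; _-_)
  import Data.Integer.Properties as ℤP
  open import Data.Integer.Tactic.RingSolver using (solve-∀)
  open import Data.Sum as Sum using (_⊎_; inj₁; inj₂)
  open import Relation.Nullary using (¬?)
  open import Relation.Nullary.Decidable using (decidable-stable)
  open IntegerSums

  dot : ∀ {n} → (Fin n → ℤ) → (Fin n → ℤ) → ℤ
  dot {n} a x = ∑[ i < n ] (a i * x i)

  NontrivialSolution : ∀ {m n} → (Fin m → Fin n → ℤ) → Set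
  NontrivialSolution {m} {n} e =
    Σ (Fin n → ℤ) λ x → (∃ λ i → x i ≢ 0ℤ) × (∀ j → dot (e j) x ≡ 0ℤ)

  NonzeroRows : ∀ {m n} → (Fin m → Fin n → ℤ) → Set
  NonzeroRows {m} {n} e =
    Σ (Fin n → Fin m) λ h → Injective _≡_ _≡_ h × (∀ i → ∃ λ c → e (h i) c ≢ 0ℤ)

  eliminate : ∀ {m n} → (Fin m → Fin (suc n) → ℤ) → Fin m → Fin m → Fin n → ℤ
  eliminate e j₀ j i = e j₀ zero * e j (suc i) - e j zero * e j₀ (suc i)

  extend-solution : ∀ {m n} (e : Fin m → Fin (suc n) → ℤ) (j₀ : Fin m) → e j₀ zero ≢ 0ℤ →
    NontrivialSolution (eliminate e j₀) → NontrivialSolution e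
  extend-solution {m} {n} e j₀ pivot≢0 (y , (i₀ , yi₀≢0) , y-sol) = x , (suc i₀ , x≢0) , x-sol
    where
    a = e j₀ zero
    S : Fin m → ℤ
    S j = dot (e j ∘ suc) y
    x : Fin (suc n) → ℤ
    x zero = - S j₀
    x (suc i) = a * y i
    x≢0 : a * y i₀ ≢ 0ℤ
    x≢0 p with ℤP.i*j≡0⇒i≡0∨j≡0 a p
    ... | inj₁ a≡0 = pivot≢0 a≡0
    ... | inj₂ y≡0 = yi₀≢0 y≡0
    x-sol : ∀ j → dot (e j) x ≡ 0ℤ
    x-sol j = begin
      e j zero * (- S j₀) + ∑[ i < n ] (e j (suc i) * (a * y i))
        ≡⟨ cong (e j zero * (- S j₀) +_) (trans (sum-cong-≗ (λ i → swap (e j (suc i)) a (y i)))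
                                                (sym (*-distribˡ-sum a (λ i → e j (suc i) * y i)))) ⟩
      e j zero * (- S j₀) + a * S j
        ≡⟨ regroup (e j zero) (S j₀) a (S j) ⟩
      a * S j + (- e j zero) * S j₀
        ≡⟨ cong₂ _+_ (*-distribˡ-sum a (λ i → e j (suc i) * y i)) (*-distribˡ-sum (- e j zero) (λ i → e j₀ (suc i) * y i)) ⟩
      ∑[ i < n ] (a * (e j (suc i) * y i)) + ∑[ i < n ] ((- e j zero) * (e j₀ (suc i) * y i))
        ≡⟨ sym (∑-distrib-+ (λ i → a * (e j (suc i) * y i)) (λ i → (- e j zero) * (e j₀ (suc i) * y i))) ⟩
      ∑[ i < n ] (a * (e j (suc i) * y i) + (- e j zero) * (e j₀ (suc i) * y i))
        ≡⟨ sum-cong-≗ (λ i → factor a (e j (suc i)) (e j zero) (e j₀ (suc i)) (y i)) ⟩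
      dot (eliminate e j₀ j) y
        ≡⟨ y-sol j ⟩
      0ℤ ∎
      where
      open ≡-Reasoning
      swap : ∀ p q r → p * (q * r) ≡ q * (p * r)
      swap = solve-∀
      regroup : ∀ p s q t → p * (- s) + q * t ≡ q * t + (- p) * s
      regroup = solve-∀
      factor : ∀ p q r s t → p * (q * t) + (- r) * (s * t) ≡ (p * q - r * s) * t
      factor = solve-∀

  extend-rows : ∀ {m n} (e : Fin m → Fin (suc n) → ℤ) (j₀ : Fin m) → e j₀ zero ≢ 0ℤ →
    NonzeroRows (eliminate e j₀) → NonzeroRows e
  extend-rows e j₀ pivot≢0 (h , h-inj , h≢0) = h⁺ , h⁺-inj , h⁺≢0
    where
    -- the pivot row is eliminated to zero, so it is not among the rows h
    h≢j₀ : ∀ i → h i ≢ j₀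
    h≢j₀ i refl with h≢0 i
    ... | c , ne = ne (cancel (e j₀ zero) (e j₀ (suc c)))
      where
      cancel : ∀ p q → p * q - p * q ≡ 0ℤ
      cancel = solve-∀
    h⁺ : Fin _ → Fin _
    h⁺ zero = j₀
    h⁺ (suc i) = h i
    h⁺-inj : Injective _≡_ _≡_ h⁺
    h⁺-inj {zero}  {zero}  _ = refl
    h⁺-inj {zero}  {suc i} e = ⊥-elim (h≢j₀ i (sym e))
    h⁺-inj {suc i} {zero}  e = ⊥-elim (h≢j₀ i e)
    h⁺-inj {suc i} {suc k} e = cong suc (h-inj e)
    -- a row of e whose image under elimination is nonzero is itself nonzero
    h⁺≢0 : ∀ i → ∃ λ c → e (h⁺ i) c ≢ 0ℤ
    h⁺≢0 zero = zero , pivot≢0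
    h⁺≢0 (suc i) with e (h i) zero ℤP.≟ 0ℤ | h≢0 i
    ... | no  first≢0 | _      = zero , first≢0
    ... | yes first≡0 | c , ne = suc c , λ q → ne (vanish (e j₀ zero) (e j₀ (suc c)) first≡0 q)
      where
      vanish : ∀ p s {r q} → r ≡ 0ℤ → q ≡ 0ℤ → p * q - r * s ≡ 0ℤ
      vanish p s refl refl = cong₂ _-_ (ℤP.*-zeroʳ p) (ℤP.*-zeroˡ s)

  solution-or-rows : ∀ {m} n (e : Fin m → Fin n → ℤ) → NontrivialSolution e ⊎ NonzeroRows e
  solution-or-rows zero e = inj₂ ((λ ()) , (λ { {()} }) , (λ ()))
  solution-or-rows (suc n) e with FinP.any? (λ j → ¬? (e j zero ℤP.≟ 0ℤ))
  ... | yes (j₀ , pivot≢0) =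
    Sum.map (extend-solution e j₀ pivot≢0) (extend-rows e j₀ pivot≢0) (solution-or-rows n (eliminate e j₀))
  ... | no no-pivot = inj₁ (x , (zero , λ ()) , x-sol)
    where
    -- no row involves the first unknown, so the first unit vector solves the system
    x : Fin (suc n) → ℤ
    x zero = 1ℤ
    x (suc i) = 0ℤ
    x-sol : ∀ j → dot (e j) x ≡ 0ℤ
    x-sol j = cong₂ _+_ (trans (ℤP.*-identityʳ _) first≡0) (sum-zero (λ i → ℤP.*-zeroʳ (e j (suc i))))
      where
      first≡0 : e j zero ≡ 0ℤ
      first≡0 = decidable-stable (e j zero ℤP.≟ 0ℤ) (λ ne → no-pivot (j , ne))

module QuadraticForms where
  open import Data.Integer using (ℤ; +_; -[1+_]; 0ℤ; _+_; _*_; _≤_; _<_; +≤+; +<+; positive; nonNegative)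
  import Data.Integer.Properties as ℤP
  open import Data.Integer.Tactic.RingSolver using (solve-∀)
  open import Relation.Nullary.Decidable using (decidable-stable)
  open IntegerSums
  open HomogeneousSystems using (dot)

  square-nonneg : ∀ a → 0ℤ ≤ a * a
  square-nonneg (+ k) = subst (0ℤ ≤_) (ℤP.pos-* k k) (+≤+ z≤n)
  square-nonneg -[1+ k ] = +≤+ z≤n

  square-pos : ∀ a → a ≢ 0ℤ → 0ℤ < a * a
  square-pos (+ zero) a≢0 = ⊥-elim (a≢0 refl)
  square-pos (+ suc k) _ = +<+ (s≤s z≤n)
  square-pos -[1+ k ] _ = +<+ (s≤s z≤n)

  *-square-mono-≤ : ∀ {a b} y → a ≤ b → a * (y * y) ≤ b * (y * y)
  *-square-mono-≤ y = ℤP.*-monoʳ-≤-nonNeg (y * y) {{nonNegative (square-nonneg y)}}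

  *-square-mono-< : ∀ {a b} y → y ≢ 0ℤ → a < b → a * (y * y) < b * (y * y)
  *-square-mono-< y y≢0 = ℤP.*-monoʳ-<-pos (y * y) {{positive (square-pos y y≢0)}}

  -- gram h a : the matrix of the quadratic form x ↦ Σⱼ hⱼ ⟨aⱼ , x⟩².
  gram : ∀ {m n} → (Fin m → ℤ) → (Fin m → Fin n → ℤ) → Fin n → Fin n → ℤ
  gram {m} h a u v = ∑[ j < m ] (h j * a j u * a j v)

  sum-of-squares : ∀ {m n} (h : Fin m → ℤ) (a : Fin m → Fin n → ℤ) (x : Fin n → ℤ) →
    ∑[ j < m ] (h j * (dot (a j) x * dot (a j) x)) ≡ ∑[ u < n ] ∑[ v < n ] (gram h a u v * (x u * x v))
  sum-of-squares {m} {n} h a x = begin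
    ∑[ j < m ] (h j * (dot (a j) x * dot (a j) x))
      ≡⟨ sum-cong-≗ expand ⟩
    ∑[ j < m ] ∑[ u < n ] ∑[ v < n ] T j u v
      ≡⟨ ∑-comm (λ j u → ∑[ v < n ] T j u v) ⟩
    ∑[ u < n ] ∑[ j < m ] ∑[ v < n ] T j u v
      ≡⟨ sum-cong-≗ (λ u → ∑-comm (λ j v → T j u v)) ⟩
    ∑[ u < n ] ∑[ v < n ] ∑[ j < m ] T j u v
      ≡⟨ sum-cong-≗ (λ u → sum-cong-≗ (λ v → sym (*-distribʳ-sum (x u * x v) (λ j → h j * a j u * a j v)))) ⟩
    ∑[ u < n ] ∑[ v < n ] (gram h a u v * (x u * x v)) ∎
    where
    open ≡-Reasoning
    T : Fin m → Fin n → Fin n → ℤ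
    T j u v = h j * a j u * a j v * (x u * x v)
    rearrange : ∀ p q r s t → p * (q * r * (s * t)) ≡ p * q * s * (r * t)
    rearrange = solve-∀
    expand : ∀ j → h j * (dot (a j) x * dot (a j) x) ≡ ∑[ u < n ] ∑[ v < n ] T j u v
    expand j = begin
      h j * (dot (a j) x * dot (a j) x)
        ≡⟨ cong (h j *_) (sum-*-sum (λ u → a j u * x u) (λ v → a j v * x v)) ⟩
      h j * ∑[ u < n ] ∑[ v < n ] (a j u * x u * (a j v * x v))
        ≡⟨ *-distribˡ-sum (h j) (λ u → ∑[ v < n ] (a j u * x u * (a j v * x v))) ⟩
      ∑[ u < n ] (h j * ∑[ v < n ] (a j u * x u * (a j v * x v)))
        ≡⟨ sum-cong-≗ (λ u → *-distribˡ-sum (h j) (λ v → a j u * x u * (a j v * x v))) ⟩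
      ∑[ u < n ] ∑[ v < n ] (h j * (a j u * x u * (a j v * x v)))
        ≡⟨ sum-cong-≗ (λ u → sum-cong-≗ (λ v → rearrange (h j) (a j u) (x u) (a j v) (x v))) ⟩
      ∑[ u < n ] ∑[ v < n ] T j u v ∎

  vanishing-form : ∀ {n} (L : ℕ) (C : Fin n → Fin n → ℤ) (x : Fin n → ℤ) →
    (∀ u v → + L * (x u * x v) ≤ C u v * (x u * x v)) →
    (∀ u → x u ≢ 0ℤ → + L * (x u * x u) < C u u * (x u * x u)) →
    ∑[ u < n ] ∑[ v < n ] (C u v * (x u * x v)) ≡ 0ℤ → ∀ u → x u ≡ 0ℤ
  vanishing-form {n} L C x ≤C <C form≡0 u₀ = decidable-stable (x u₀ ℤP.≟ 0ℤ) λ xu₀≢0 →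
    ℤP.<-irrefl refl (begin-strict
      0ℤ                                                 ≡⟨ sym (ℤP.*-zeroʳ (+ L)) ⟩
      + L * 0ℤ                                           ≤⟨ ℤP.*-monoˡ-≤-nonNeg (+ L) (square-nonneg S) ⟩
      + L * (S * S)                                      ≡⟨ cong (+ L *_) (sum-*-sum x x) ⟩
      + L * ∑[ u < n ] ∑[ v < n ] (x u * x v)            ≡⟨ scale ⟩
      ∑[ u < n ] ∑[ v < n ] (+ L * (x u * x v))          <⟨ sum-mono-< (λ u → sum-mono-≤ (≤C u)) u₀
                                                              (sum-mono-< (≤C u₀) u₀ (<C u₀ xu₀≢0)) ⟩
      ∑[ u < n ] ∑[ v < n ] (C u v * (x u * x v))        ≡⟨ form≡0 ⟩
      0ℤ                                                 ∎)
    where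
    open ℤP.≤-Reasoning
    S = sum x
    scale : + L * ∑[ u < n ] ∑[ v < n ] (x u * x v) ≡ ∑[ u < n ] ∑[ v < n ] (+ L * (x u * x v))
    scale = trans (*-distribˡ-sum (+ L) (λ u → ∑[ v < n ] (x u * x v))) (sum-cong-≗ (λ u → *-distribˡ-sum (+ L) (λ v → x u * x v)))

module Saturation {L n m : ℕ} (M : Matrix n m) (saturated : Saturated M (lT22 (suc L))) where
  open import Data.Nat using (_+_; _≤_; _<_; _≤?_)
  import Data.Nat.Properties as ℕP
  open import Data.Bool using (_∨_)
  open import Relation.Nullary using (¬?)
  open import Relation.Nullary.Decidable using (dec-true; dec-false; decidable-stable)
  import Data.Bool.Properties as BoolP
  open import Data.Vec using (Vec; lookup; replicate; tabulate)
  import Data.Vec.Properties as VecP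
  open import Data.Sum using (_⊎_; inj₁; inj₂)
  open Counting
  open AllOnesBlock

  simple : Simple M
  simple = proj₁ saturated

  free : ¬ Contains M (lT22 (suc L))
  free = proj₁ (proj₂ saturated)

  B : Fin m → Fin n → Bool
  B j i = entry M i j

  codeg : Fin n → Fin n → ℕ
  codeg = codegree M

  codeg-sym : ∀ a b → codeg a b ≡ codeg b a
  codeg-sym a b = count-cong (λ j → BoolP.∧-comm (B j a) (B j b))

  codeg≤L : ∀ {a b} → a ≢ b → codeg a b ≤ L
  codeg≤L a≢b = ℕP.≮⇒≥ λ L<codeg → free (block-from-codegree M a≢b L<codeg)

  SaturatingPair : Vec Bool n → Set
  SaturatingPair x = Σ (Fin n) λ a → Σ (Fin n) λ b →
    a ≢ b × lookup x a ≡ true × lookup x b ≡ true × L ≤ codeg a b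

  -- Saturation: appending a new column x creates lT₂², which must use x at a saturating pair.
  new-column-saturates : (x : Vec Bool n) → (∀ j → ¬ (M j ≡ x)) → SaturatingPair x
  new-column-saturates x x-new with codegree-from-block (append M x) (proj₂ (proj₂ saturated) x x-new)
  ... | a , b , a≢b , l≤ = use (lookup x a) (lookup x b) refl refl l≤
    where
    -- the codegree in append M x exceeds that in M by one exactly when x has 1s at a and b
    use : ∀ xa xb → lookup x a ≡ xa → lookup x b ≡ xb → suc L ≤ bit (xa ∧ xb) + codeg a b → SaturatingPair x
    use true  true  xa xb l≤ = a , b , a≢b , xa , xb , ℕ.s≤s⁻¹ l≤
    use true  false _  _  l≤ = ⊥-elim (free (block-from-codegree M a≢b l≤))
    use false _     _  _  l≤ = ⊥-elim (free (block-from-codegree M a≢b l≤))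

  is-column : (x : Vec Bool n) → ¬ SaturatingPair x → ∃ λ j → M j ≡ x
  is-column x no-pair with FinP.any? (λ j → VecP.≡-dec BoolP._≟_ (M j) x)
  ... | yes found = found
  ... | no  absent = ⊥-elim (no-pair (new-column-saturates x (λ j e → absent (j , e))))

  zeros : Vec Bool n
  zeros = replicate n false

  is : Fin n → Fin n → Bool
  is u i = does (u Fin.≟ i)

  unit : Fin n → Vec Bool n
  unit u = tabulate (is u)

  pair : Fin n → Fin n → Vec Bool n
  pair u v = tabulate (λ i → is u i ∨ is v i)

  in-pair : ∀ {u v i} → lookup (pair u v) i ≡ true → u ≡ i ⊎ v ≡ i
  in-pair {u} {v} {i} p with u Fin.≟ i | v Fin.≟ i | trans (sym (VecP.lookup∘tabulate (λ k → is u k ∨ is v k) i)) p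
  ... | yes u≡i | _       | _ = inj₁ u≡i
  ... | no _    | yes v≡i | _ = inj₂ v≡i
  ... | no _    | no _    | ()

  in-unit : ∀ {u i} → lookup (unit u) i ≡ true → u ≡ i
  in-unit {u} {i} p = ≟-sound (trans (sym (VecP.lookup∘tabulate (is u) i)) p)

  unit-has : ∀ u → lookup (unit u) u ≡ true
  unit-has u = trans (VecP.lookup∘tabulate (is u) u) (dec-true (u Fin.≟ u) refl)

  pair-has-first : ∀ u v → lookup (pair u v) u ≡ true
  pair-has-first u v = trans (VecP.lookup∘tabulate (λ i → is u i ∨ is v i) u) (cong (_∨ is v u) (dec-true (u Fin.≟ u) refl))

  pair-has-second : ∀ u v → lookup (pair u v) v ≡ true
  pair-has-second u v = trans (VecP.lookup∘tabulate (λ i → is u i ∨ is v i) v)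
    (trans (cong (is u v ∨_) (dec-true (v Fin.≟ v) refl)) (BoolP.∨-zeroʳ (is u v)))

  pair-lacks : ∀ {u v i} → u ≢ i → v ≢ i → lookup (pair u v) i ≡ false
  pair-lacks {u} {v} {i} u≢i v≢i = trans (VecP.lookup∘tabulate (λ k → is u k ∨ is v k) i)
    (cong₂ _∨_ (dec-false (u Fin.≟ i) u≢i) (dec-false (v Fin.≟ i) v≢i))

  zeros≢unit : ∀ u → zeros ≢ unit u
  zeros≢unit u e = case trans (sym (VecP.lookup-replicate u false)) (trans (cong (λ c → lookup c u) e) (unit-has u)) of λ ()

  unit-injective : ∀ {u v} → unit u ≡ unit v → u ≡ v
  unit-injective {u} {v} e = sym (in-unit (trans (cong (λ c → lookup c u) (sym e)) (unit-has u)))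

  entry-of : ∀ {j x} → M j ≡ x → ∀ i → B j i ≡ lookup x i
  entry-of M≡x i = cong (λ c → lookup c i) M≡x

  zero-column : ∃ λ j → M j ≡ zeros
  zero-column = is-column zeros λ (a , _ , _ , xa , _) →
    case trans (sym (VecP.lookup-replicate a false)) xa of λ ()

  unit-column : ∀ u → ∃ λ j → M j ≡ unit u
  unit-column u = is-column (unit u) λ (a , b , a≢b , xa , xb , _) →
    a≢b (trans (sym (in-unit {u} xa)) (in-unit {u} xb))

  pair-column : ∀ {u v} → u ≢ v → codeg u v < L → ∃ λ j → M j ≡ pair u v
  pair-column {u} {v} u≢v low = is-column (pair u v) λ (a , b , a≢b , xa , xb , L≤) →
    saturated-pair (in-pair xa) (in-pair xb) a≢b L≤
    where
    saturated-pair : ∀ {a b} → u ≡ a ⊎ v ≡ a → u ≡ b ⊎ v ≡ b → a ≢ b → L ≤ codeg a b → ⊥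
    saturated-pair (inj₁ refl) (inj₁ refl) a≢b _  = a≢b refl
    saturated-pair (inj₂ refl) (inj₂ refl) a≢b _  = a≢b refl
    saturated-pair (inj₁ refl) (inj₂ refl) _   L≤ = ℕP.<⇒≱ low L≤
    saturated-pair (inj₂ refl) (inj₁ refl) _   L≤ = ℕP.<⇒≱ low (subst (L ≤_) (codeg-sym v u) L≤)

  weight : Fin m → ℕ
  weight j = count (B j)

  heavy : Fin m → Bool
  heavy j = does (2 ≤? weight j)

  heavy-if-two : ∀ {j a b} → a ≢ b → B j a ≡ true → B j b ≡ true → heavy j ≡ true
  heavy-if-two {j} a≢b ja jb = dec-true (2 ≤? weight j) (witnesses⇒≤count (B j) (witnesses₂ a≢b ja jb))

  two-if-heavy : ∀ {j} → heavy j ≡ true → Σ (Fin n) λ a → Σ (Fin n) λ b → a ≢ b × B j a ≡ true × B j b ≡ true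
  two-if-heavy {j} h with count⇒witnesses (B j) (does-true (2 ≤? weight j) h)
  ... | f , f-inj , jf = f zero , f (suc zero) , (λ e → case f-inj e of λ ()) , jf zero , jf (suc zero)

  zeros-light : ∀ {j} → M j ≡ zeros → heavy j ≡ false
  zeros-light {j} M≡0 with heavy j in h
  ... | false = refl
  ... | true with two-if-heavy h
  ...   | a , _ , _ , ja , _ = case trans (sym ja) (trans (entry-of M≡0 a) (VecP.lookup-replicate a false)) of λ ()

  unit-light : ∀ {j u} → M j ≡ unit u → heavy j ≡ false
  unit-light {j} {u} M≡e with heavy j in h
  ... | false = refl
  ... | true with two-if-heavy h
  ...   | a , b , a≢b , ja , jb = ⊥-elim (a≢b (trans (sym (is-u ja)) (is-u jb)))
    where
    is-u : ∀ {i} → B j i ≡ true → u ≡ i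
    is-u {i} ji = in-unit {u} (trans (sym (entry-of M≡e i)) ji)

  hdeg : Fin n → ℕ
  hdeg u = count (λ j → heavy j ∧ B j u)

  -- Columns through u and v are heavy, so a heavy column through u avoiding v
  -- pushes the heavy degree of u above the codegree of u and v.
  codeg<hdeg : ∀ {u v j} → u ≢ v → heavy j ≡ true → B j u ≡ true → B j v ≡ false → suc (codeg u v) ≤ hdeg u
  codeg<hdeg {u} {v} {j} u≢v h ju jv =
    count-mono-< (λ j → heavy j ∧ B j u) (common M u v) common⇒heavy j (∧-intro h ju) (cong₂ _∧_ ju jv)
    where
    common⇒heavy : ∀ j' → common M u v j' ≡ true → heavy j' ∧ B j' u ≡ true
    common⇒heavy j' both = ∧-intro (heavy-if-two u≢v (∧-conicalˡ _ _ both) (∧-conicalʳ _ _ both)) (∧-conicalˡ _ _ both)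

  separating-row : ∀ {j₁ j₂} → j₁ ≢ j₂ → ∃ λ w → B j₁ w ≢ B j₂ w
  separating-row {j₁} {j₂} j₁≢j₂ with FinP.any? (λ w → ¬? (B j₁ w BoolP.≟ B j₂ w))
  ... | yes found = found
  ... | no  none  = ⊥-elim (j₁≢j₂ (simple (begin
    M j₁                        ≡⟨ sym (VecP.tabulate∘lookup (M j₁)) ⟩
    tabulate (B j₁)             ≡⟨ VecP.tabulate-cong (λ w → decidable-stable (B j₁ w BoolP.≟ B j₂ w) (λ d → none (w , d))) ⟩
    tabulate (B j₂)             ≡⟨ VecP.tabulate∘lookup (M j₂) ⟩
    M j₂                        ∎)))
    where open ≡-Reasoning

  separates : ∀ {j a b} → B j a ≡ true → B j b ≡ false → a ≢ b
  separates ja jb refl = case trans (sym ja) jb of λ ()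

  -- If L ≥ 2, some column through a pair u, v of codegree L misses a row w:
  -- two distinct columns through u and v are separated by a row.
  column-missing : 2 ≤ L → ∀ {u v} → L ≤ codeg u v →
    Σ (Fin m) λ j → Σ (Fin n) λ w → B j u ≡ true × B j v ≡ true × B j w ≡ false
  column-missing 2≤L {u} {v} L≤ with count⇒witnesses (common M u v) (ℕP.≤-trans 2≤L L≤)
  ... | f , f-inj , both with separating-row {f zero} {f (suc zero)} (λ e → case f-inj e of λ ())
  ... | w , differ with B (f zero) w in e₀ | B (f (suc zero)) w in e₁
  ... | false | _     = f zero , w , ∧-conicalˡ _ _ (both zero) , ∧-conicalʳ _ _ (both zero) , e₀
  ... | true  | false = f (suc zero) , w , ∧-conicalˡ _ _ (both (suc zero)) , ∧-conicalʳ _ _ (both (suc zero)) , e₁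
  ... | true  | true  = ⊥-elim (differ refl)

  pair-column-missing : ∀ {u v w} → u ≢ v → u ≢ w → w ≢ v → codeg u w < L →
    Σ (Fin m) λ j → heavy j ≡ true × B j u ≡ true × B j v ≡ false
  pair-column-missing {u} {v} {w} u≢v u≢w w≢v low with pair-column u≢w low
  ... | j , M≡uw = j , heavy-if-two u≢w ju jw , ju , trans (entry-of M≡uw v) (pair-lacks u≢v w≢v)
    where
    ju = trans (entry-of M≡uw u) (pair-has-first u w)
    jw = trans (entry-of M≡uw w) (pair-has-second u w)

  -- If L ≥ 2, a pair u, v of codegree L forces the heavy degree of u above L:
  -- take a column through u and v missing a row w; either u, w also has codegree L,
  -- or the column {u, w} is a heavy column through u missing v.
  saturated⇒hdeg : 2 ≤ L → ∀ {u v} → u ≢ v → L ≤ codeg u v → L < hdeg u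
  saturated⇒hdeg 2≤L {u} {v} u≢v L≤ with column-missing 2≤L L≤
  ... | j , w , ju , jv , jw with L ≤? codeg u w
  ...   | yes L≤uw = ℕP.≤-trans (s≤s L≤uw) (codeg<hdeg (separates ju jw) (heavy-if-two u≢v ju jv) ju jw)
  ...   | no  uw<L with pair-column-missing u≢v (separates ju jw) (separates jv jw ∘ sym) (ℕP.≰⇒> uw<L)
  ...     | j₃ , h₃ , j₃u , j₃v = ℕP.≤-trans (s≤s L≤) (codeg<hdeg u≢v h₃ j₃u j₃v)

  weight-through-two : ∀ {j u w w'} → u ≢ w → u ≢ w' → w ≢ w' → B j w ≡ true → B j w' ≡ true →
    bit (B j u) + 2 ≤ weight j
  weight-through-two {j} {u} u≢w u≢w' w≢w' jw jw' with B j u in ju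
  ... | true  = witnesses⇒≤count (B j) (witnesses₃ u≢w u≢w' w≢w' ju jw jw')
  ... | false = witnesses⇒≤count (B j) (witnesses₂ w≢w' jw jw')

module HeavyColumnsSpan {L n m : ℕ} (M : Matrix n m) (saturated : Saturated M (lT22 (suc L)))
                        (2≤L : 2 ℕ.≤ L) (3≤n : 3 ℕ.≤ n) where
  open import Data.Integer using (ℤ; +_; -[1+_]; 0ℤ; 1ℤ; _+_; _*_; -_; _-_; _≤_; _<_; +≤+; +<+)
  import Data.Integer.Properties as ℤP
  open import Data.Integer.Tactic.RingSolver using (solve-∀)
  import Data.Nat.Properties as ℕP
  open import Data.Sum using (inj₁; inj₂; [_,_]′)
  open import Relation.Nullary using (¬?)
  open import Relation.Nullary.Decidable using (_×-dec_)
  open import Data.Bool using (_∨_)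
  open import Data.Vec using (lookup)
  import Data.Vec.Properties as VecP
  open Counting using (bit; count⇒witnesses)
  open AllOnesBlock using (common)
  open IntegerSums
  open HomogeneousSystems using (dot)
  open QuadraticForms
  open Saturation M saturated

  double-zero : ∀ a → - a + - a ≡ 0ℤ → a ≡ 0ℤ
  double-zero (+ ℕ.zero) _ = refl
  double-zero (+ ℕ.suc k) ()
  double-zero -[1+ k ] ()

  weight-too-large : ∀ b {w} → bit b ℕ.+ 2 ℕ.≤ w → w ≢ bit b ℕ.+ bit b
  weight-too-large true  (ℕ.s≤s (ℕ.s≤s ())) refl
  weight-too-large false () refl

  heavy-row : Fin m → Fin n → ℤ
  heavy-row j i = ι (heavy j) * ι (B j i)

  module _ (x : Fin n → ℤ) (orthogonal : ∀ j → dot (heavy-row j) x ≡ 0ℤ) where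

    s : Fin m → ℤ
    s j = dot (λ i → ι (B j i)) x

    weighted-zero : ∀ j → ι (heavy j) * s j ≡ 0ℤ
    weighted-zero j = trans (*-distribˡ-sum (ι (heavy j)) (λ i → ι (B j i) * x i))
      (trans (sum-cong-≗ (λ i → sym (ℤP.*-assoc (ι (heavy j)) (ι (B j i)) (x i)))) (orthogonal j))

    heavy-zero : ∀ {j} → heavy j ≡ true → s j ≡ 0ℤ
    heavy-zero {j} h = trans (sym (ℤP.*-identityˡ (s j))) (subst (λ b → ι b * s j ≡ 0ℤ) h (weighted-zero j))

    -- On a pair u, v of codegree below L, x is antisymmetric: the column {u, v} is heavy.
    pair-sum : ∀ {u v} → u ≢ v → codeg u v ℕ.< L → x u + x v ≡ 0ℤ
    pair-sum {u} {v} u≢v low with pair-column u≢v low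
    ... | j , M≡uv = begin
      x u + x v                                                ≡⟨ sym (cong₂ _+_ (sum-δ u x) (sum-δ v x)) ⟩
      ∑[ i < n ] (δ u i * x i) + ∑[ i < n ] (δ v i * x i)      ≡⟨ sym (∑-distrib-+ (λ i → δ u i * x i) (λ i → δ v i * x i)) ⟩
      ∑[ i < n ] (δ u i * x i + δ v i * x i)                   ≡⟨ sum-cong-≗ split ⟩
      s j                                                      ≡⟨ heavy-zero (heavy-if-two u≢v (jpair u (pair-has-first u v)) (jpair v (pair-has-second u v))) ⟩
      0ℤ                                                       ∎
      where
      open ≡-Reasoning
      jpair : ∀ i → lookup (pair u v) i ≡ true → B j i ≡ true
      jpair i p = trans (entry-of M≡uv i) p
      split : ∀ i → δ u i * x i + δ v i * x i ≡ ι (B j i) * x i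
      split i = begin
        δ u i * x i + δ v i * x i        ≡⟨ sym (ℤP.*-distribʳ-+ (x i) (δ u i) (δ v i)) ⟩
        (ι (is u i) + ι (is v i)) * x i  ≡⟨ cong (_* x i) (sym (ι-∨ (is u i) (is v i) disjoint)) ⟩
        ι (is u i ∨ is v i) * x i        ≡⟨ cong (λ b → ι b * x i) (sym (trans (entry-of M≡uv i) (VecP.lookup∘tabulate (λ k → is u k ∨ is v k) i))) ⟩
        ι (B j i) * x i                  ∎
        where
        disjoint : is u i ≡ true → is v i ≡ true → ⊥
        disjoint p q = u≢v (trans (≟-sound p) (sym (≟-sound q)))

    C : Fin n → Fin n → ℤ
    C = gram (λ j → ι (heavy j)) (λ j i → ι (B j i))

    -- Off the diagonal only heavy columns can contain both rows, so C is the codegree.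
    C-off : ∀ {u v} → u ≢ v → C u v ≡ + codeg u v
    C-off {u} {v} u≢v = trans (sum-cong-≗ through-both) (sum-ι (common M u v))
      where
      through-both : ∀ j → ι (heavy j) * ι (B j u) * ι (B j v) ≡ ι (B j u ∧ B j v)
      through-both j with heavy j in h | B j u in ju | B j v in jv
      ... | true  | true  | true  = refl
      ... | true  | true  | false = refl
      ... | true  | false | _     = refl
      ... | false | true  | true  = case trans (sym (heavy-if-two u≢v ju jv)) h of λ ()
      ... | false | true  | false = refl
      ... | false | false | _     = refl

    C-diag : ∀ u → C u u ≡ + hdeg u
    C-diag u = trans (sum-cong-≗ (λ j → idempotent (heavy j) (B j u))) (sum-ι (λ j → heavy j ∧ B j u))
      where
      idempotent : ∀ h b → ι h * ι b * ι b ≡ ι (h ∧ b)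
      idempotent true  true  = refl
      idempotent true  false = refl
      idempotent false true  = refl
      idempotent false false = refl

    -- The quadratic form of C vanishes at x, being the sum of squares of the heavy column values.
    form-zero : ∑[ u < n ] ∑[ v < n ] (C u v * (x u * x v)) ≡ 0ℤ
    form-zero = begin
      ∑[ u < n ] ∑[ v < n ] (C u v * (x u * x v))
        ≡⟨ sym (sum-of-squares (λ j → ι (heavy j)) (λ j i → ι (B j i)) x) ⟩
      ∑[ j < m ] (ι (heavy j) * (s j * s j))
        ≡⟨ sum-zero (λ j → trans (sym (ℤP.*-assoc (ι (heavy j)) (s j) (s j)))
                                 (trans (cong (_* s j) (weighted-zero j)) (ℤP.*-zeroˡ (s j)))) ⟩
      0ℤ ∎
      where open ≡-Reasoning

    pair-opposite : ∀ {u v} → u ≢ v → codeg u v ℕ.< L → x v ≡ - x u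
    pair-opposite {u} {v} u≢v low = begin
      x v                 ≡⟨ cancel (x u) (x v) ⟩
      - x u + (x u + x v) ≡⟨ cong (λ t → - x u + t) (pair-sum u≢v low) ⟩
      - x u + 0ℤ          ≡⟨ ℤP.+-identityʳ (- x u) ⟩
      - x u               ∎
      where
      open ≡-Reasoning
      cancel : ∀ a b → b ≡ - a + (a + b)
      cancel = solve-∀

    opposite : ∀ {u} → (∀ v → u ≢ v → codeg u v ℕ.< L) → ∀ i → u ≢ i → x i ≡ - x u
    opposite lonely i u≢i = pair-opposite u≢i (lonely i u≢i)

    opposite-value : ∀ {u} → (∀ i → u ≢ i → x i ≡ - x u) → ∀ j →
      s j ≡ + weight j * (- x u) + ι (B j u) * (x u + x u)
    opposite-value {u} opp j = begin
      s j
        ≡⟨ sum-cong-≗ pointwise ⟩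
      ∑[ i < n ] (ι (B j i) * (- x u) + δ u i * (ι (B j i) * (x u + x u)))
        ≡⟨ ∑-distrib-+ (λ i → ι (B j i) * (- x u)) (λ i → δ u i * (ι (B j i) * (x u + x u))) ⟩
      ∑[ i < n ] (ι (B j i) * (- x u)) + ∑[ i < n ] (δ u i * (ι (B j i) * (x u + x u)))
        ≡⟨ cong₂ _+_ (trans (sym (*-distribʳ-sum (- x u) (λ i → ι (B j i)))) (cong (_* - x u) (sum-ι (B j))))
                     (sum-δ u (λ i → ι (B j i) * (x u + x u))) ⟩
      + weight j * (- x u) + ι (B j u) * (x u + x u) ∎
      where
      open ≡-Reasoning
      at-u : ∀ b a → b * a ≡ b * (- a) + 1ℤ * (b * (a + a))
      at-u = solve-∀
      off-u : ∀ b a c → b * (- a) ≡ b * (- a) + 0ℤ * c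
      off-u = solve-∀
      pointwise : ∀ i → ι (B j i) * x i ≡ ι (B j i) * (- x u) + δ u i * (ι (B j i) * (x u + x u))
      pointwise i with u Fin.≟ i
      ... | yes refl = at-u (ι (B j u)) (x u)
      ... | no  u≢i  = trans (cong (ι (B j i) *_) (opp i u≢i)) (off-u (ι (B j i)) (x u) (ι (B j i) * (x u + x u)))

    -- A heavy column through rows w, w' other than u forces x u = 0 when x is - x u away
    -- from u: its value x u (2·[u ∈ j] - weight j) vanishes while weight j > 2·[u ∈ j].
    column-forces-zero : ∀ {u w w' j} → (∀ i → u ≢ i → x i ≡ - x u) →
      u ≢ w → u ≢ w' → w ≢ w' → B j w ≡ true → B j w' ≡ true → x u ≡ 0ℤ
    column-forces-zero {u} {w} {w'} {j} opp u≢w u≢w' w≢w' jw jw' =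
      [ id , (λ balanced → ⊥-elim (weight-too-large (B j u) (weight-through-two u≢w u≢w' w≢w' jw jw')
                                     (sym (ℤP.+-injective (ℤP.i-j≡0⇒i≡j _ _ balanced))))) ]′
      (ℤP.i*j≡0⇒i≡0∨j≡0 (x u) factored)
      where
      factor : ∀ a b c → a * (b + b - c) ≡ c * (- a) + b * (a + a)
      factor = solve-∀
      factored : x u * (ι (B j u) + ι (B j u) - + weight j) ≡ 0ℤ
      factored = trans (factor (x u) (ι (B j u)) (+ weight j))
        (trans (sym (opposite-value opp j)) (heavy-zero (heavy-if-two w≢w' jw jw')))

    -- A row u all of whose pairs have codegree below L has x u = 0: take two further rows
    -- w, w'; either their pair column gives - 2 x u = 0, or a column passes through both.
    lonely-zero : ∀ {u} → (∀ v → u ≢ v → codeg u v ℕ.< L) → x u ≡ 0ℤ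
    lonely-zero {u} lonely with two-others 3≤n u
    ... | w , w' , u≢w , u≢w' , w≢w' with L ℕ.≤? codeg w w'
    ...   | no low = double-zero (x u) (begin
      - x u + - x u ≡⟨ sym (cong₂ _+_ (opposite lonely w u≢w) (opposite lonely w' u≢w')) ⟩
      x w + x w'    ≡⟨ pair-sum w≢w' (ℕP.≰⇒> low) ⟩
      0ℤ            ∎)
      where open ≡-Reasoning
    ...   | yes L≤ with count⇒witnesses (common M w w') (ℕP.≤-trans (ℕP.≤-trans (ℕ.s≤s ℕ.z≤n) 2≤L) L≤)
    ...     | f , _ , both = column-forces-zero (opposite lonely) u≢w u≢w' w≢w'
                               (∧-conicalˡ _ _ (both zero)) (∧-conicalʳ _ _ (both zero))

    -- Where x u ≠ 0 some pair at u has codegree L, so the heavy degree of u exceeds L.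
    strict-diagonal : ∀ u → x u ≢ 0ℤ → + L * (x u * x u) < C u u * (x u * x u)
    strict-diagonal u xu≢0 = subst (λ c → + L * (x u * x u) < c * (x u * x u)) (sym (C-diag u))
      (*-square-mono-< (x u) xu≢0 (+<+ L<hdeg))
      where
      L<hdeg : L ℕ.< hdeg u
      L<hdeg with FinP.any? (λ v → ¬? (u Fin.≟ v) ×-dec (L ℕ.≤? codeg u v))
      ... | yes (v , u≢v , L≤) = saturated⇒hdeg 2≤L u≢v L≤
      ... | no  none = ⊥-elim (xu≢0 (lonely-zero (λ v u≢v → ℕP.≰⇒> (λ L≤ → none (v , u≢v , L≤)))))

    -- Termwise, the form of C dominates L x u x v: off the diagonal C u v ≤ L, with
    -- equality unless x v = - x u.
    dominated : ∀ u v → + L * (x u * x v) ≤ C u v * (x u * x v)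
    dominated u v with u Fin.≟ v
    ... | yes refl with x u ℤP.≟ 0ℤ
    ...   | no  xu≢0 = ℤP.<⇒≤ (strict-diagonal u xu≢0)
    ...   | yes xu≡0 rewrite xu≡0 = ℤP.≤-reflexive (trans (ℤP.*-zeroʳ (+ L)) (sym (ℤP.*-zeroʳ (C u u))))
    dominated u v | no u≢v rewrite C-off u≢v with ℕP.m≤n⇒m<n∨m≡n (codeg≤L u≢v)
    ... | inj₂ codeg≡L rewrite codeg≡L = ℤP.≤-refl
    ... | inj₁ low rewrite pair-opposite u≢v low = begin
      + L * (x u * - x u)            ≡⟨ negate (+ L) (x u) ⟩
      - (+ L * (x u * x u))          ≤⟨ ℤP.neg-mono-≤ (*-square-mono-≤ (x u) (+≤+ (ℕP.<⇒≤ low))) ⟩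
      - (+ codeg u v * (x u * x u))  ≡⟨ sym (negate (+ codeg u v) (x u)) ⟩
      + codeg u v * (x u * - x u)    ∎
      where
      open ℤP.≤-Reasoning
      negate : ∀ c a → c * (a * - a) ≡ - (c * (a * a))
      negate = solve-∀

    orthogonal⇒zero : ∀ u → x u ≡ 0ℤ
    orthogonal⇒zero = vanishing-form L C x dominated strict-diagonal form-zero

module ColumnCount {L n m : ℕ} (M : Matrix n m) (saturated : Saturated M (lT22 (suc L)))
                   (2≤L : 2 ℕ.≤ L) (3≤n : 3 ℕ.≤ n) where
  open import Data.Nat using (_+_; _≤_)
  import Data.Nat.Properties as ℕP
  open import Data.Bool using (not)
  open import Data.Integer using (0ℤ)
  import Data.Integer.Properties as ℤP
  open import Data.Sum using (inj₁; inj₂)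
  open import Data.Vec using (Vec)
  open Counting
  open HomogeneousSystems using (solution-or-rows)
  open IntegerSums using (ι)
  open Saturation M saturated
  open HeavyColumnsSpan M saturated 2≤L 3≤n using (heavy-row; orthogonal⇒zero)

  -- The heavy columns span: a nonzero row of the heavy system is a heavy column, and the
  -- system has only the trivial solution, so it has n distinct nonzero rows.
  heavy-columns : Witnesses heavy n
  heavy-columns with solution-or-rows n heavy-row
  ... | inj₁ (x , (u , xu≢0) , orth) = ⊥-elim (xu≢0 (orthogonal⇒zero x orth u))
  ... | inj₂ (h , h-inj , nonzero) = h , h-inj , λ i → nonzero⇒heavy (nonzero i)
    where
    nonzero⇒heavy : ∀ {j} → (∃ λ c → heavy-row j c ≢ 0ℤ) → heavy j ≡ true
    nonzero⇒heavy {j} (c , row≢0) with heavy j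
    ... | true  = refl
    ... | false = ⊥-elim (row≢0 (ℤP.*-zeroˡ (ι (B j c))))

  light-columns : Witnesses (not ∘ heavy) (suc n)
  light-columns = g , g-inj , λ k → cong not (g-light k)
    where
    column : Fin (suc n) → Vec Bool n
    column zero = zeros
    column (suc i) = unit i
    column-injective : Injective _≡_ _≡_ column
    column-injective {zero}  {zero}  _ = refl
    column-injective {zero}  {suc i} e = ⊥-elim (zeros≢unit i e)
    column-injective {suc i} {zero}  e = ⊥-elim (zeros≢unit i (sym e))
    column-injective {suc i} {suc k} e = cong suc (unit-injective e)
    present : ∀ k → ∃ λ j → M j ≡ column k
    present zero = zero-column
    present (suc i) = unit-column i
    g : Fin (suc n) → Fin m
    g k = proj₁ (present k)
    g-inj : Injective _≡_ _≡_ g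
    g-inj {k} {k'} e = column-injective (trans (sym (proj₂ (present k))) (trans (cong M e) (proj₂ (present k'))))
    g-light : ∀ k → heavy (g k) ≡ false
    g-light zero = zeros-light (proj₂ zero-column)
    g-light (suc i) = unit-light {u = i} (proj₂ (unit-column i))

  saturated-columns : suc n + n ≤ m
  saturated-columns = begin
    suc n + n                         ≤⟨ ℕP.+-mono-≤ (witnesses⇒≤count (not ∘ heavy) light-columns)
                                                     (witnesses⇒≤count heavy heavy-columns) ⟩
    count (not ∘ heavy) + count heavy ≡⟨ ℕP.+-comm (count (not ∘ heavy)) (count heavy) ⟩
    count heavy + count (not ∘ heavy) ≡⟨ count-complement heavy ⟩
    m                                 ∎
    where open ℕP.≤-Reasoning

open import Data.Nat using (ℕ; _≤_; _+_; _*_)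
open import Data.Nat.Tactic.RingSolver using (solve-∀)

mainTheorem7 : (l n : ℕ) → 3 ≤ l → 3 ≤ n →
    (m : ℕ) (M : Matrix n m) → Saturated M (lT22 l) → 2 * n + 1 ≤ m
mainTheorem7 (suc L) n (s≤s 2≤L) 3≤n m M saturated =
  subst (_≤ m) (arithmetic n) (ColumnCount.saturated-columns M saturated 2≤L 3≤n)
  where
  arithmetic : ∀ n → suc n + n ≡ 2 * n + 1
  arithmetic = solve-∀
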